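{- The equation \[ x^{2}+5^{a}\cdot 11^{b}=y^{4} \] has no solutions in integers $x\geq 1$, $y\geq 1$, $a\geq 0$, $b\geq 0$ with $\gcd(x,y)=1$. -}

{-# OPTIONS --safe #-}
-- Write y⁴ − x² = d e with d = y² − x and e = y² + x, so that d e = 5^a 11^b, d < e and
-- d + e = 2y². A prime dividing d and e divides 2x and y², so coprimality of x and y leaves
-- 5 and 11 each dividing at most one factor. A divisor of 5^a 11^b prime to 5 is a power of 11,
-- hence ≡ 1 (mod 5); so if 5 divides a factor then 2y² ≡ 1 (mod 5). Otherwise d and e are
-- coprime powers of 11 with d < e, i.e. 1 and a multiple of 11, and 2y² ≡ 1 (mod 11).
-- Both are impossible, as 2 is a quadratic non-residue modulo 5 and modulo 11.

module Submission where

open import Data.Nat using (ℕ; zero; suc; _+_; _*_; _^_; _≤_; _<_; _%_; _∸_; NonZero; nonTrivial⇒≢1; z≤n; s≤s)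
open import Data.Nat.Properties
open import Data.Nat.Divisibility
open import Data.Nat.DivMod using (%-distribˡ-*; m%n%n≡m%n; m%n<n; %-remove-+ˡ; %-remove-+ʳ; %-congˡ)
open import Data.Nat.GCD using (gcd)
open import Data.Nat.Coprimality as Coprimality using (Coprime; coprime-divisor; gcd≡1⇒coprime)
open import Data.Nat.Primality
open import Data.Nat.Solver using (module +-*-Solver)
open import Function using (_∘_)
open import Data.Product using (_×_; _,_; ∃; ∃₂)
open import Data.Sum using (_⊎_; inj₁; inj₂)
open import Data.Empty using (⊥)
open import Relation.Binary.PropositionalEquality
open import Relation.Nullary using (¬_; yes; no; contradiction; ¬?)
open import Relation.Nullary.Decidable using (from-yes)

private variable
  d m n p q : ℕ

prime∤⇒coprime : Prime p → p ∤ d → Coprime p d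
prime∤⇒coprime pp p∤d (i∣p , i∣d) with prime⇒irreducible pp i∣p
... | inj₁ i≡1 = i≡1
... | inj₂ refl = contradiction i∣d p∤d

prime∣m^n⇒prime∣m : Prime p → ∀ n → p ∣ m ^ n → p ∣ m
prime∣m^n⇒prime∣m (prime _) zero p∣1 = contradiction (∣1⇒≡1 p∣1) nonTrivial⇒≢1
prime∣m^n⇒prime∣m {m = m} pp (suc n) p∣m^[1+n] with euclidsLemma m (m ^ n) pp p∣m^[1+n]
... | inj₁ p∣m   = p∣m
... | inj₂ p∣m^n = prime∣m^n⇒prime∣m pp n p∣m^n

∣p^i*n⇒p^k*∣n : Prime p → ∀ i → d ∣ p ^ i * n → ∃₂ λ k d′ → d ≡ p ^ k * d′ × d′ ∣ n
∣p^i*n⇒p^k*∣n {d = d} {n} pp zero d∣n =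
  0 , d , sym (*-identityˡ d) , subst (d ∣_) (*-identityˡ n) d∣n
∣p^i*n⇒p^k*∣n {p} {d} {n} pp (suc i) d∣p^[1+i]*n
  with p ∣? d | subst (d ∣_) (*-assoc p (p ^ i) n) d∣p^[1+i]*n
... | yes (divides q refl) | q*p∣p*[p^i*n] =
  let k , q′ , q≡p^k*q′ , q′∣n = ∣p^i*n⇒p^k*∣n pp i q∣p^i*n
  in suc k , q′ , trans (cong (_* p) q≡p^k*q′) (p^k*q′*p≡p^[1+k]*q′ k q′) , q′∣n
  where
  q∣p^i*n : q ∣ p ^ i * n
  q∣p^i*n = *-cancelʳ-∣ p {{prime⇒nonZero pp}} (subst (q * p ∣_) (*-comm p _) q*p∣p*[p^i*n])
  p^k*q′*p≡p^[1+k]*q′ : ∀ k q′ → p ^ k * q′ * p ≡ p ^ suc k * q′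
  p^k*q′*p≡p^[1+k]*q′ k q′ = trans (*-comm (p ^ k * q′) p) (sym (*-assoc p (p ^ k) q′))
... | no p∤d | d∣p*[p^i*n] =
  ∣p^i*n⇒p^k*∣n pp i (coprime-divisor (Coprimality.sym (prime∤⇒coprime pp p∤d)) d∣p*[p^i*n])

∣p^i*q^j⇒≡p^k*q^l : Prime p → Prime q → ∀ i j → d ∣ p ^ i * q ^ j → ∃₂ λ k l → d ≡ p ^ k * q ^ l
∣p^i*q^j⇒≡p^k*q^l {q = q} pp pq i j d∣p^i*q^j with ∣p^i*n⇒p^k*∣n pp i d∣p^i*q^j
... | k , d′ , refl , d′∣q^j with ∣p^i*n⇒p^k*∣n pq j (subst (d′ ∣_) (sym (*-identityʳ (q ^ j))) d′∣q^j)
...   | l , d″ , refl , d″∣1 rewrite ∣1⇒≡1 d″∣1 | *-identityʳ (q ^ l) = k , l , refl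

%-distribˡ-^ : ∀ m n p .{{_ : NonZero p}} → (m ^ n) % p ≡ ((m % p) ^ n) % p
%-distribˡ-^ m zero    p = refl
%-distribˡ-^ m (suc n) p = begin
  (m * m ^ n) % p                     ≡⟨ %-distribˡ-* m (m ^ n) p ⟩
  ((m % p) * (m ^ n % p)) % p         ≡⟨ cong (λ t → ((m % p) * t) % p) (%-distribˡ-^ m n p) ⟩
  ((m % p) * ((m % p) ^ n % p)) % p   ≡⟨ cong (λ t → (t * ((m % p) ^ n % p)) % p) (m%n%n≡m%n m p) ⟨
  ((m % p % p) * ((m % p) ^ n % p)) % p ≡⟨ %-distribˡ-* (m % p) ((m % p) ^ n) p ⟨
  ((m % p) * (m % p) ^ n) % p ∎
  where open ≡-Reasoning

[11^n]%5≡1 : ∀ n → (11 ^ n) % 5 ≡ 1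
[11^n]%5≡1 n = trans (%-distribˡ-^ 11 n 5) (cong (_% 5) (^-zeroˡ n))

[2*y^2]%p≡[2*[y%p]^2]%p : ∀ y p .{{_ : NonZero p}} → (2 * y ^ 2) % p ≡ (2 * (y % p) ^ 2) % p
[2*y^2]%p≡[2*[y%p]^2]%p y p = begin
  (2 * y ^ 2) % p                   ≡⟨ %-distribˡ-* 2 (y ^ 2) p ⟩
  ((2 % p) * (y ^ 2 % p)) % p       ≡⟨ cong (λ t → ((2 % p) * t) % p) (%-distribˡ-^ y 2 p) ⟩
  ((2 % p) * ((y % p) ^ 2 % p)) % p ≡⟨ %-distribˡ-* 2 ((y % p) ^ 2) p ⟨
  (2 * (y % p) ^ 2) % p ∎
  where open ≡-Reasoning

[2*y^2]%p≢1 : ∀ p .{{_ : NonZero p}} → (∀ {r} → r < p → (2 * r ^ 2) % p ≢ 1) → ∀ y → (2 * y ^ 2) % p ≢ 1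
[2*y^2]%p≢1 p residues y = residues (m%n<n y p) ∘ trans (sym ([2*y^2]%p≡[2*[y%p]^2]%p y p))

[2*y^2]%5≢1 : ∀ y → (2 * y ^ 2) % 5 ≢ 1
[2*y^2]%5≢1 = [2*y^2]%p≢1 5 (from-yes (allUpTo? (λ r → ¬? ((2 * r ^ 2) % 5 ≟ 1)) 5))

[2*y^2]%11≢1 : ∀ y → (2 * y ^ 2) % 11 ≢ 1
[2*y^2]%11≢1 = [2*y^2]%p≢1 11 (from-yes (allUpTo? (λ r → ¬? ((2 * r ^ 2) % 11 ≟ 1)) 11))

Residues-5-11 : ℕ → Set
Residues-5-11 u = 5 ∣ u ⊎ u % 5 ≡ 1 × (11 ∣ u ⊎ u ≡ 1)

5^i*11^j-residues : ∀ i j → Residues-5-11 (5 ^ i * 11 ^ j)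
5^i*11^j-residues (suc i) j = inj₁ (∣m⇒∣m*n (11 ^ j) (m∣m*n (5 ^ i)))
5^i*11^j-residues zero    j = inj₂ (trans (%-congˡ (*-identityˡ (11 ^ j))) ([11^n]%5≡1 j) , 11-part j)
  where
  11-part : ∀ j → 11 ∣ 1 * 11 ^ j ⊎ 1 * 11 ^ j ≡ 1
  11-part zero    = inj₂ refl
  11-part (suc j) = inj₁ (∣n⇒∣m*n 1 (m∣m*n (11 ^ j)))

∣5^a*11^b⇒residues : ∀ a b → d ∣ 5 ^ a * 11 ^ b → Residues-5-11 d
∣5^a*11^b⇒residues a b d∣N with ∣p^i*q^j⇒≡p^k*q^l (from-yes (prime? 5)) (from-yes (prime? 11)) a b d∣N
... | i , j , refl = 5^i*11^j-residues i j

p∣d⇒p∤d+2x : Prime p → 2 < p → ∀ {x y} → gcd x y ≡ 1 → x + d ≡ y ^ 2 → p ∣ d → p ∤ d + 2 * x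
p∣d⇒p∤d+2x {p} {d} pp@(prime _) 2<p {x} {y} gcd≡1 x+d≡y² p∣d p∣d+2x
  with euclidsLemma 2 x pp (∣m+n∣m⇒∣n p∣d+2x p∣d)
... | inj₁ p∣2 = <⇒≱ 2<p (∣⇒≤ p∣2)
... | inj₂ p∣x = nonTrivial⇒≢1 (gcd≡1⇒coprime gcd≡1 (p∣x , p∣y))
  where
  p∣y : p ∣ y
  p∣y = prime∣m^n⇒prime∣m pp 2 (subst (p ∣_) x+d≡y² (∣m∣n⇒∣m+n p∣x p∣d))

difference-of-squares : ∀ {x n Y} → x ^ 2 + n ≡ Y ^ 2 → ∃ λ d → x + d ≡ Y × n ≡ d * (d + 2 * x)
difference-of-squares {x} {n} {Y} x²+n≡Y² = Y ∸ x , x+d≡Y , +-cancelˡ-≡ (x ^ 2) n _ (begin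
  x ^ 2 + n                           ≡⟨ x²+n≡Y² ⟩
  Y ^ 2                               ≡⟨ cong (_^ 2) x+d≡Y ⟨
  (x + (Y ∸ x)) ^ 2                   ≡⟨ square-expansion x (Y ∸ x) ⟩
  x ^ 2 + (Y ∸ x) * ((Y ∸ x) + 2 * x) ∎)
  where
  open ≡-Reasoning
  x≤Y : x ≤ Y
  x≤Y = ≮⇒≥ λ Y<x → <⇒≱ (^-monoˡ-< 2 Y<x) (subst (x ^ 2 ≤_) x²+n≡Y² (m≤m+n (x ^ 2) n))
  x+d≡Y : x + (Y ∸ x) ≡ Y
  x+d≡Y = m+[n∸m]≡n x≤Y
  square-expansion : ∀ a b → (a + b) ^ 2 ≡ a ^ 2 + b * (b + 2 * a)
  square-expansion = solve 2 (λ a b → (a :+ b) :^ 2 := a :^ 2 :+ b :* (b :+ con 2 :* a)) refl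
    where open +-*-Solver

d+e≢2*y^2 : ∀ {d e y} → Residues-5-11 d → Residues-5-11 e → (5 ∣ d → 5 ∤ e) → (11 ∣ d → 11 ∤ e) →
            d < e → d + e ≢ 2 * y ^ 2
d+e≢2*y^2 {d} {e} {y} d-residues e-residues 5∣d⇒5∤e 11∣d⇒11∤e d<e d+e≡2y² = cases d-residues e-residues
  where
  [d+e]%5≢1 : (d + e) % 5 ≢ 1
  [d+e]%5≢1 = [2*y^2]%5≢1 y ∘ subst (λ s → s % 5 ≡ 1) d+e≡2y²
  [d+e]%11≢1 : (d + e) % 11 ≢ 1
  [d+e]%11≢1 = [2*y^2]%11≢1 y ∘ subst (λ s → s % 11 ≡ 1) d+e≡2y²
  cases : Residues-5-11 d → Residues-5-11 e → ⊥
  cases (inj₁ 5∣d) (inj₁ 5∣e) = 5∣d⇒5∤e 5∣d 5∣e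
  cases (inj₁ 5∣d) (inj₂ (e≡1[5] , _)) = [d+e]%5≢1 (trans (%-remove-+ˡ e 5∣d) e≡1[5])
  cases (inj₂ (d≡1[5] , _)) (inj₁ 5∣e) = [d+e]%5≢1 (trans (%-remove-+ʳ d 5∣e) d≡1[5])
  cases (inj₂ (_ , inj₁ 11∣d)) (inj₂ (_ , inj₁ 11∣e)) = 11∣d⇒11∤e 11∣d 11∣e
  cases (inj₂ (_ , inj₁ 11∣d)) (inj₂ (_ , inj₂ e≡1)) =
    [d+e]%11≢1 (trans (%-remove-+ˡ e 11∣d) (cong (_% 11) e≡1))
  cases (inj₂ (_ , inj₂ d≡1)) (inj₂ (_ , inj₁ 11∣e)) =
    [d+e]%11≢1 (trans (%-remove-+ʳ d 11∣e) (cong (_% 11) d≡1))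
  cases (inj₂ (_ , inj₂ d≡1)) (inj₂ (_ , inj₂ e≡1)) = <-irrefl (trans d≡1 (sym e≡1)) d<e

proposition2 : (x y a b : ℕ) → 1 ≤ x → 1 ≤ y → gcd x y ≡ 1 →
    ¬ (x ^ 2 + 5 ^ a * 11 ^ b ≡ y ^ 4)
proposition2 x y a b 1≤x _ gcd≡1 x²+N≡y⁴
  with difference-of-squares {x} {5 ^ a * 11 ^ b} {y ^ 2} (trans x²+N≡y⁴ (sym (^-*-assoc y 2 2)))
... | d , x+d≡y² , N≡d*e =
  d+e≢2*y^2 {y = y} (∣5^a*11^b⇒residues a b (divides e (trans N≡d*e (*-comm d e))))
            (∣5^a*11^b⇒residues a b (divides d N≡d*e))
            (p∣d⇒p∤d+2x (from-yes (prime? 5)) (s≤s (s≤s (s≤s z≤n))) {x} {y} gcd≡1 x+d≡y²)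
            (p∣d⇒p∤d+2x (from-yes (prime? 11)) (s≤s (s≤s (s≤s z≤n))) {x} {y} gcd≡1 x+d≡y²)
            (m<m+n d (≤-trans 1≤x (m≤m+n x (x + 0))))
            d+e≡2y²
  where
  e : ℕ
  e = d + 2 * x
  d+e≡2y² : d + e ≡ 2 * y ^ 2
  d+e≡2y² = trans (solve 2 (λ x d → d :+ (d :+ con 2 :* x) := con 2 :* (x :+ d)) refl x d) (cong (2 *_) x+d≡y²)
    where open +-*-Solver
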